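{- Let $w$ be an infinite word with infinitely many palindromic prefixes, and let $(n_i)_{i\ge1}$ be the increasing sequence of lengths of its palindromic prefixes (so $n_1=0$). The following are equivalent: (i) $n_{i+1}\le 2n_i+1$ for all $i\ge1$; (ii) there exists an admissible function $\psi$ such that $w=w_\psi$.
   Context: The alphabet $\mathcal{A}$ is arbitrary (finite or infinite) and disjoint from $\mathbb{N}^*=\{1,2,\dots\}$; the empty word $\varepsilon$ is a palindrome. For finite words with $u'$ a prefix of $u$, $u'^{ -1}u$ denotes the word $u''$ with $u=u'u''$. An admissible function is a map $\psi:\mathbb{N}^*\to\mathbb{N}^*\sqcup\mathcal{A}$ such that for every $n\ge1$, either $\psi(n)\in\mathcal{A}$ or $1\le\psi(n)\le n-1$. Given such $\psi$, define finite words $\pi_1=\varepsilon$ and for $i\ge1$: $\pi_{i+1}=\pi_i\,\pi_{\psi(i)}^{ -1}\pi_i$ if $\psi(i)\in\mathbb{N}^*$, and $\pi_{i+1}=\pi_i\,\psi(i)\,\pi_i$ if $\psi(i)\in\mathcal{A}$. (Each $\pi_i$ is a palindrome, $\pi_i$ is a proper prefix of $\pi_{i+1}$, and $\pi_{\psi(i)}$ is a prefix of $\pi_i$.) The infinite word $w_\psi$ is the limit of $(\pi_i)$. -}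

module Defs where

open import Data.Nat using (ℕ; zero; suc; _≤_; _<_; _∸_; _≤ᵇ_)
open import Data.Bool using (true; false)
open import Data.List using (List; []; _∷_; _++_; drop; length; map; reverse; upTo)
open import Data.Sum using (_⊎_; inj₁; inj₂)
open import Data.Product using (Σ; _×_; ∃; ∃-syntax)
open import Relation.Binary.PropositionalEquality using (_≡_)

pref : {A : Set} → (ℕ → A) → ℕ → List A
pref w m = map w (upTo m)

Palindrome : {A : Set} → List A → Set
Palindrome u = reverse u ≡ u

IsPrefixOf : {A : Set} → List A → (ℕ → A) → Set
IsPrefixOf u w = pref w (length u) ≡ u

StrictlyIncreasing : (ℕ → ℕ) → Set
StrictlyIncreasing f = ∀ i → f i < f (suc i)

-- A function ψ : ℕ* → ℕ* ⊔ A, encoded as ℕ → ℕ ⊎ A (value at 0 is ignored;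
-- inj₁ = natural-number values, inj₂ = letters; the disjoint sum models
-- the disjointness of A and ℕ*).
Admissible : {A : Set} → (ℕ → ℕ ⊎ A) → Set
Admissible {A} ψ =
  ∀ n → 1 ≤ n →
    (∃[ a ] ψ n ≡ inj₂ a) ⊎ (∃[ m ] (ψ n ≡ inj₁ m × 1 ≤ m × m ≤ n ∸ 1))

-- piTab ψ k j = π_j for 1 ≤ j ≤ k+1.
-- π_{u'}^{-1} π_i is implemented as dropping |π_{u'}| letters (π_{ψ(i)} is
-- always a prefix of π_i, so this agrees with the partial operation).
piTab : {A : Set} → (ℕ → ℕ ⊎ A) → ℕ → ℕ → List A
piTab ψ zero j = []
piTab ψ (suc k) j with j ≤ᵇ suc k
... | true = piTab ψ k j
... | false with ψ (suc k)
...   | inj₁ m = piTab ψ k (suc k) ++ drop (length (piTab ψ k m)) (piTab ψ k (suc k))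
...   | inj₂ a = piTab ψ k (suc k) ++ (a ∷ piTab ψ k (suc k))

-- π_i (meaningful for i ≥ 1).
π : {A : Set} → (ℕ → ℕ ⊎ A) → ℕ → List A
π ψ i = piTab ψ i i

-- w = w_ψ : w is the limit of (π_i), i.e. every π_i is a prefix of w
-- (the |π_i| are strictly increasing, so this determines w).
IsWψ : {A : Set} → (ℕ → ℕ ⊎ A) → (ℕ → A) → Set
IsWψ ψ w = ∀ i → 1 ≤ i → IsPrefixOf (π ψ i) w

-- Two palindromic prefixes u, v of w with |u| ≤ |v| give w the period |v| − |u| on its first
-- |u| letters. So if |v| = |u| + K with 0 < K ≤ |u|, the prefix of length |u| − K is again a
-- palindrome and v = u · ((|u| − K) letters dropped from u), while if |v| = 2|u| + 1 then v = u a u.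
-- These are the two rules producing π_{i+1} from π_i, so under (i) an admissible ψ generates
-- the palindromic prefixes one after the other. Conversely, both rules produce palindromes and at
-- most double the length (plus one); as the π_i are palindromic prefixes, every gap between
-- consecutive palindromic prefixes lies inside a gap between consecutive π_i, whence (i).

module Submission where

open import Defs
open import Data.Bool using (true; false; T)
open import Data.Empty using (⊥-elim)
open import Data.List
  using (List; []; _∷_; _++_; take; drop; length; reverse; upTo; applyUpTo; applyDownFrom)
open import Data.List.Properties
  using ( ∷-injectiveˡ; ∷-injectiveʳ; ++-assoc; length-++; length-drop; length-map; length-upTo
        ; map-upTo; reverse-++; reverse-applyUpTo; take++drop≡id)
open import Data.Nat using (ℕ; zero; suc; _≤_; _<_; _+_; _*_; _∸_; _≤ᵇ_; z≤n; s≤s; z<s; s<s)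
open import Data.Nat.Induction using (<-rec)
open import Data.Nat.Properties
open import Algebra.Properties.CommutativeSemigroup +-commutativeSemigroup using (xy∙z≈xz∙y)
open import Data.Nat.Tactic.RingSolver using (solve-∀)
open import Data.Product using (_×_; _,_; ∃-syntax)
open import Data.Sum using (_⊎_; inj₁; inj₂)
open import Function.Base using (_∘_)
open import Function.Bundles using (_⇔_; mk⇔; Equivalence)
open import Relation.Binary.PropositionalEquality
  using (_≡_; refl; sym; trans; cong; cong₂; subst; module ≡-Reasoning)
open import Relation.Nullary using (yes; no)

2*n+1≡n+[1+n] : ∀ n → 2 * n + 1 ≡ n + suc n
2*n+1≡n+[1+n] = solve-∀

DoublingBounded : (ℕ → ℕ) → Set
DoublingBounded f = ∀ i → f (suc i) ≤ 2 * f i + 1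

module _ {f : ℕ → ℕ} (f-inc : StrictlyIncreasing f) where

  strictlyIncreasing⇒monotone : ∀ {i j} → i ≤ j → f i ≤ f j
  strictlyIncreasing⇒monotone {j = zero}  z≤n = ≤-refl
  strictlyIncreasing⇒monotone {j = suc j} i≤1+j with m≤n⇒m<n∨m≡n i≤1+j
  ... | inj₁ (s≤s i≤j) = ≤-trans (strictlyIncreasing⇒monotone i≤j) (<⇒≤ (f-inc j))
  ... | inj₂ refl      = ≤-refl

  strictlyIncreasing⇒reflects-< : ∀ {i j} → f i < f j → i < j
  strictlyIncreasing⇒reflects-< {i} {j} fi<fj with i <? j
  ... | yes i<j = i<j
  ... | no  i≮j = ⊥-elim (<⇒≱ fi<fj (strictlyIncreasing⇒monotone (≮⇒≥ i≮j)))

  strictlyIncreasing⇒inflationary : ∀ k → k ≤ f k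
  strictlyIncreasing⇒inflationary zero    = z≤n
  strictlyIncreasing⇒inflationary (suc k) = ≤-<-trans (strictlyIncreasing⇒inflationary k) (f-inc k)

doublingBounded-fromSubsequence : ∀ {n ℓ : ℕ → ℕ} → StrictlyIncreasing n → StrictlyIncreasing ℓ →
  ℓ 0 ≡ 0 → (∀ k → ∃[ i ] n i ≡ ℓ k) → DoublingBounded ℓ → DoublingBounded n
doublingBounded-fromSubsequence {n} {ℓ} n-inc ℓ-inc ℓ₀≡0 ℓ⊆n ℓ-dbl i =
  below (suc (n i)) (strictlyIncreasing⇒inflationary ℓ-inc (suc (n i)))
  where
  -- n (suc i) is at most the first ℓ k above n i, which is at most 2 ℓ (k − 1) + 1 ≤ 2 n i + 1.
  below : ∀ k → n i < ℓ k → n (suc i) ≤ 2 * n i + 1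
  below zero    nᵢ<ℓ₀ = ⊥-elim (n≮0 (subst (n i <_) ℓ₀≡0 nᵢ<ℓ₀))
  below (suc k) nᵢ<ℓₖ₊₁ with n i <? ℓ k | ℓ⊆n (suc k)
  ... | yes nᵢ<ℓₖ | _ = below k nᵢ<ℓₖ
  ... | no  nᵢ≮ℓₖ | j , nⱼ≡ℓₖ₊₁ = begin
    n (suc i)    ≤⟨ strictlyIncreasing⇒monotone n-inc
                      (strictlyIncreasing⇒reflects-< n-inc (subst (n i <_) (sym nⱼ≡ℓₖ₊₁) nᵢ<ℓₖ₊₁)) ⟩
    n j          ≡⟨ nⱼ≡ℓₖ₊₁ ⟩
    ℓ (suc k)    ≤⟨ ℓ-dbl k ⟩
    2 * ℓ k + 1  ≤⟨ +-monoˡ-≤ 1 (*-monoʳ-≤ 2 (≮⇒≥ nᵢ≮ℓₖ)) ⟩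
    2 * n i + 1  ∎
    where open ≤-Reasoning

module _ {A : Set} where

  applyUpTo-+ : ∀ (f : ℕ → A) m n → applyUpTo f (m + n) ≡ applyUpTo f m ++ applyUpTo (λ t → f (m + t)) n
  applyUpTo-+ f zero    n = refl
  applyUpTo-+ f (suc m) n = cong (f 0 ∷_) (applyUpTo-+ (λ t → f (suc t)) m n)

  drop-applyUpTo-+ : ∀ (f : ℕ → A) m n → drop m (applyUpTo f (m + n)) ≡ applyUpTo (λ t → f (m + t)) n
  drop-applyUpTo-+ f zero    n = refl
  drop-applyUpTo-+ f (suc m) n = drop-applyUpTo-+ (λ t → f (suc t)) m n

  take-applyUpTo : ∀ (f : ℕ → A) {m n} → m ≤ n → take m (applyUpTo f n) ≡ applyUpTo f m
  take-applyUpTo f z≤n       = refl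
  take-applyUpTo f (s≤s m≤n) = cong (f 0 ∷_) (take-applyUpTo (λ t → f (suc t)) m≤n)

  applyUpTo-cong : ∀ {f g : ℕ → A} n → (∀ {t} → t < n → f t ≡ g t) → applyUpTo f n ≡ applyUpTo g n
  applyUpTo-cong zero    f≗g = refl
  applyUpTo-cong (suc n) f≗g = cong₂ _∷_ (f≗g z<s) (applyUpTo-cong n (λ t<n → f≗g (s<s t<n)))

  applyUpTo-cong⁻ : ∀ {f g : ℕ → A} {n} → applyUpTo f n ≡ applyUpTo g n → ∀ {t} → t < n → f t ≡ g t
  applyUpTo-cong⁻ {n = suc n} eq {zero}  _         = ∷-injectiveˡ eq
  applyUpTo-cong⁻ {n = suc n} eq {suc t} (s<s t<n) = applyUpTo-cong⁻ (∷-injectiveʳ eq) t<n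

  applyDownFrom≡applyUpTo : ∀ (f : ℕ → A) n → applyDownFrom f n ≡ applyUpTo (λ t → f (n ∸ suc t)) n
  applyDownFrom≡applyUpTo f zero    = refl
  applyDownFrom≡applyUpTo f (suc n) = cong (f n ∷_) (applyDownFrom≡applyUpTo f n)

  length-pref : ∀ (w : ℕ → A) N → length (pref w N) ≡ N
  length-pref w N = trans (length-map w (upTo N)) (length-upTo N)

  take-pref : ∀ (w : ℕ → A) {m N} → m ≤ N → take m (pref w N) ≡ pref w m
  take-pref w {m} {N} m≤N = begin
    take m (pref w N)        ≡⟨ cong (take m) (map-upTo w N) ⟩
    take m (applyUpTo w N)   ≡⟨ take-applyUpTo w m≤N ⟩
    applyUpTo w m            ≡⟨ map-upTo w m ⟨
    pref w m                 ∎
    where open ≡-Reasoning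

  reverse-pref : ∀ (w : ℕ → A) N → reverse (pref w N) ≡ applyUpTo (λ t → w (N ∸ suc t)) N
  reverse-pref w N = begin
    reverse (pref w N)       ≡⟨ cong reverse (map-upTo w N) ⟩
    reverse (applyUpTo w N)  ≡⟨ reverse-applyUpTo w N ⟩
    applyDownFrom w N        ≡⟨ applyDownFrom≡applyUpTo w N ⟩
    applyUpTo (λ t → w (N ∸ suc t)) N ∎
    where open ≡-Reasoning

  u++a∷u-palindrome : ∀ {u : List A} a → Palindrome u → Palindrome (u ++ a ∷ u)
  u++a∷u-palindrome {u} a u-pal = begin
    reverse (u ++ a ∷ u)              ≡⟨ reverse-++ u (a ∷ u) ⟩
    reverse (a ∷ u) ++ reverse u      ≡⟨ cong (_++ reverse u) (reverse-++ (a ∷ []) u) ⟩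
    (reverse u ++ a ∷ []) ++ reverse u ≡⟨ cong (λ v → (v ++ a ∷ []) ++ v) u-pal ⟩
    (u ++ a ∷ []) ++ u                ≡⟨ ++-assoc u (a ∷ []) u ⟩
    u ++ a ∷ u                        ∎
    where open ≡-Reasoning

  p++s++s-palindrome : ∀ {p s : List A} → Palindrome p → Palindrome (p ++ s) → Palindrome ((p ++ s) ++ s)
  p++s++s-palindrome {p} {s} p-pal ps-pal = begin
    reverse ((p ++ s) ++ s)        ≡⟨ reverse-++ (p ++ s) s ⟩
    reverse s ++ reverse (p ++ s)  ≡⟨ cong (reverse s ++_) ps-pal ⟩
    reverse s ++ p ++ s            ≡⟨ ++-assoc (reverse s) p s ⟨
    (reverse s ++ p) ++ s          ≡⟨ cong (λ q → (reverse s ++ q) ++ s) p-pal ⟨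
    (reverse s ++ reverse p) ++ s  ≡⟨ cong (_++ s) (reverse-++ p s) ⟨
    reverse (p ++ s) ++ s          ≡⟨ cong (_++ s) ps-pal ⟩
    (p ++ s) ++ s                  ∎
    where open ≡-Reasoning

Mirror : {A : Set} → (ℕ → A) → ℕ → Set
Mirror w N = ∀ a b → suc (a + b) ≡ N → w a ≡ w b

module _ {A : Set} {w : ℕ → A} where

  palindrome⇒mirror : ∀ {N} → Palindrome (pref w N) → Mirror w N
  palindrome⇒mirror {N} pal a b refl =
    sym (trans (cong w (sym (m+n∸m≡n a b)))
               (applyUpTo-cong⁻ {f = λ t → w (N ∸ suc t)} {g = w} reflected (s≤s (m≤m+n a b))))
    where
    reflected : applyUpTo (λ t → w (N ∸ suc t)) N ≡ applyUpTo w N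
    reflected = trans (sym (reverse-pref w N)) (trans pal (map-upTo w N))

  mirror⇒palindrome : ∀ {N} → Mirror w N → Palindrome (pref w N)
  mirror⇒palindrome {N} mirror = begin
    reverse (pref w N)                 ≡⟨ reverse-pref w N ⟩
    applyUpTo (λ t → w (N ∸ suc t)) N  ≡⟨ applyUpTo-cong N (λ t<N → sym (mirror _ _ (m+[n∸m]≡n t<N))) ⟩
    applyUpTo w N                      ≡⟨ map-upTo w N ⟨
    pref w N                           ∎
    where open ≡-Reasoning

  mirrors⇒period : ∀ {N L d} → Mirror w N → Mirror w L → L + d ≡ N → ∀ {t} → t < L → w (t + d) ≡ w t
  mirrors⇒period {d = d} mirror-N mirror-L refl {t} t<L with m≤n⇒∃[o]m+o≡n t<L
  ... | x , refl = trans (mirror-N (t + d) x (cong suc (xy∙z≈xz∙y t d x))) (sym (mirror-L t x refl))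

  mirrors⇒mirror : ∀ {N L M K} → Mirror w N → Mirror w L → M + K ≡ L → L + K ≡ N → Mirror w M
  mirrors⇒mirror {K = K} mirror-N mirror-L refl L+K≡N a b refl =
    trans (mirror-L a (b + K) (cong suc (sym (+-assoc a b K))))
          (mirrors⇒period mirror-N mirror-L L+K≡N (≤-trans (s≤s (m≤n+m b a)) (m≤m+n _ K)))

  pref-centre : ∀ {N L} → Mirror w N → Mirror w L → L + suc L ≡ N →
                pref w N ≡ pref w L ++ w L ∷ pref w L
  pref-centre {L = L} mirror-N mirror-L refl = begin
    pref w (L + suc L)
      ≡⟨ map-upTo w (L + suc L) ⟩
    applyUpTo w (L + suc L)
      ≡⟨ applyUpTo-+ w L (suc L) ⟩
    applyUpTo w L ++ w (L + 0) ∷ applyUpTo (λ t → w (L + suc t)) L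
      ≡⟨ cong₂ (λ x xs → applyUpTo w L ++ x ∷ xs) (cong w (+-identityʳ L)) (applyUpTo-cong L shift) ⟩
    applyUpTo w L ++ w L ∷ applyUpTo w L
      ≡⟨ cong (λ u → u ++ w L ∷ u) (map-upTo w L) ⟨
    pref w L ++ w L ∷ pref w L
      ∎
    where
    open ≡-Reasoning
    shift : ∀ {t} → t < L → w (L + suc t) ≡ w t
    shift {t} t<L = trans (cong w (trans (+-comm L (suc t)) (sym (+-suc t L))))
                          (mirrors⇒period mirror-N mirror-L refl t<L)

  pref-return : ∀ {N L M K} → Mirror w N → Mirror w L → M + K ≡ L → L + K ≡ N →
                pref w N ≡ pref w L ++ drop M (pref w L)
  pref-return {M = M} {K} mirror-N mirror-L refl refl = begin
    pref w (M + K + K)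
      ≡⟨ map-upTo w (M + K + K) ⟩
    applyUpTo w (M + K + K)
      ≡⟨ applyUpTo-+ w (M + K) K ⟩
    applyUpTo w (M + K) ++ applyUpTo (λ t → w (M + K + t)) K
      ≡⟨ cong (applyUpTo w (M + K) ++_) (applyUpTo-cong K shift) ⟩
    applyUpTo w (M + K) ++ applyUpTo (λ t → w (M + t)) K
      ≡⟨ cong (applyUpTo w (M + K) ++_) (drop-applyUpTo-+ w M K) ⟨
    applyUpTo w (M + K) ++ drop M (applyUpTo w (M + K))
      ≡⟨ cong (λ u → u ++ drop M u) (map-upTo w (M + K)) ⟨
    pref w (M + K) ++ drop M (pref w (M + K))
      ∎
    where
    open ≡-Reasoning
    shift : ∀ {t} → t < K → w (M + K + t) ≡ w (M + t)
    shift {t} t<K = trans (cong w (xy∙z≈xz∙y M K t))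
                          (mirrors⇒period mirror-N mirror-L refl (+-monoʳ-< M t<K))

module _ {A : Set} (ψ : ℕ → ℕ ⊎ A) where

  piTab-suc : ∀ k {j} → j ≤ suc k → piTab ψ (suc k) j ≡ piTab ψ k j
  piTab-suc k {j} j≤1+k with j ≤ᵇ suc k in eq
  ... | true  = refl
  ... | false = ⊥-elim (subst T eq (≤⇒≤ᵇ j≤1+k))

  piTab-stable : ∀ k {j} → j ≤ suc k → piTab ψ k j ≡ π ψ j
  piTab-stable zero    {zero}        _ = refl
  piTab-stable zero    {suc zero}    _ = refl
  piTab-stable zero    {suc (suc _)} (s≤s ())
  piTab-stable (suc k) j≤2+k with m≤n⇒m<n∨m≡n j≤2+k
  ... | inj₁ (s≤s j≤1+k) = trans (piTab-suc k j≤1+k) (piTab-stable k j≤1+k)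
  ... | inj₂ refl        = sym (piTab-suc (suc k) ≤-refl)

  -- For variable k the stage test 2 + k ≤ᵇ 1 + k in piTab does not reduce; its true branch is refuted.
  π-letter : ∀ {k a} → ψ (suc k) ≡ inj₂ a → π ψ (suc (suc k)) ≡ π ψ (suc k) ++ a ∷ π ψ (suc k)
  π-letter {k} ψ≡a rewrite piTab-suc (suc k) ≤-refl | sym (piTab-stable k {suc k} ≤-refl)
    with suc (suc k) ≤ᵇ suc k in eq
  ... | true  = ⊥-elim (<-irrefl refl (≤ᵇ⇒≤ (suc (suc k)) (suc k) (subst T (sym eq) _)))
  ... | false rewrite ψ≡a = refl

  π-return : ∀ {k m} → ψ (suc k) ≡ inj₁ m → m ≤ suc k →
             π ψ (suc (suc k)) ≡ π ψ (suc k) ++ drop (length (π ψ m)) (π ψ (suc k))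
  π-return {k} ψ≡m m≤1+k
    rewrite piTab-suc (suc k) ≤-refl | sym (piTab-stable k {suc k} ≤-refl) | sym (piTab-stable k m≤1+k)
    with suc (suc k) ≤ᵇ suc k in eq
  ... | true  = ⊥-elim (<-irrefl refl (≤ᵇ⇒≤ (suc (suc k)) (suc k) (subst T (sym eq) _)))
  ... | false rewrite ψ≡m = refl

module FromAdmissible {A : Set} {ψ : ℕ → ℕ ⊎ A} (ψ-adm : Admissible ψ) where

  -- P k is the paper's π_{k+1}; in particular P 0 = ε.
  P : ℕ → List A
  P k = π ψ (suc k)

  ℓ : ℕ → ℕ
  ℓ k = length (P k)

  data Step (k : ℕ) : Set where
    letter : ∀ a → P (suc k) ≡ P k ++ a ∷ P k → Step k
    return : ∀ j → j < k → P (suc k) ≡ P k ++ drop (ℓ j) (P k) → Step k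

  step : ∀ k → Step k
  step k with ψ-adm (suc k) (s≤s z≤n)
  ... | inj₁ (a , ψ≡a)                = letter a (π-letter ψ ψ≡a)
  ... | inj₂ (suc j , ψ≡1+j , _ , j<k) = return j j<k (π-return ψ ψ≡1+j (s≤s (<⇒≤ j<k)))

  growth : ∀ {k} → Step k → ℕ
  growth {k} (letter _ _)   = suc (ℓ k)
  growth {k} (return j _ _) = ℓ k ∸ ℓ j

  ℓ-suc : ∀ {k} (s : Step k) → ℓ (suc k) ≡ ℓ k + growth s
  ℓ-suc {k} (letter a eq)   = trans (cong length eq) (length-++ (P k))
  ℓ-suc {k} (return j _ eq) =
    trans (cong length eq) (trans (length-++ (P k)) (cong (ℓ k +_) (length-drop (ℓ j) (P k))))

  ℓ-doublingBounded : DoublingBounded ℓ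
  ℓ-doublingBounded k = begin
    ℓ (suc k)              ≡⟨ ℓ-suc (step k) ⟩
    ℓ k + growth (step k)  ≤⟨ +-monoʳ-≤ (ℓ k) (growth≤ (step k)) ⟩
    ℓ k + suc (ℓ k)        ≡⟨ 2*n+1≡n+[1+n] (ℓ k) ⟨
    2 * ℓ k + 1            ∎
    where
    open ≤-Reasoning
    growth≤ : (s : Step k) → growth s ≤ suc (ℓ k)
    growth≤ (letter _ _)   = ≤-refl
    growth≤ (return j _ _) = m≤n⇒m≤1+n (m∸n≤m (ℓ k) (ℓ j))

  ℓ-increases : ∀ k → (∀ {j} → j < k → ℓ j < ℓ k) → ℓ k < ℓ (suc k)
  ℓ-increases k ℓ-<ℓₖ = subst (ℓ k <_) (sym (ℓ-suc (step k))) (m<m+n (ℓ k) (growth-positive (step k)))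
    where
    growth-positive : (s : Step k) → 0 < growth s
    growth-positive (letter _ _)     = z<s
    growth-positive (return j j<k _) = m<n⇒0<n∸m (ℓ-<ℓₖ j<k)

  ℓ-< : ∀ {j k} → j < k → ℓ j < ℓ k
  ℓ-< {j} {suc k} (s≤s j≤k) with m≤n⇒m<n∨m≡n j≤k
  ... | inj₁ j<k  = <-trans (ℓ-< j<k) (ℓ-increases k (λ {i} → ℓ-< {i} {k}))
  ... | inj₂ refl = ℓ-increases k (λ {i} → ℓ-< {i} {k})

  module _ {w : ℕ → A} (ψ-gen : IsWψ ψ w) where

    P≡pref : ∀ k → P k ≡ pref w (ℓ k)
    P≡pref k = sym (ψ-gen (suc k) (s≤s z≤n))

    P-prefix : ∀ {j k} → ℓ j ≤ ℓ k → P k ≡ P j ++ drop (ℓ j) (P k)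
    P-prefix {j} {k} ℓⱼ≤ℓₖ = begin
      P k                                   ≡⟨ take++drop≡id (ℓ j) (P k) ⟨
      take (ℓ j) (P k) ++ drop (ℓ j) (P k)  ≡⟨ cong (λ u → take (ℓ j) u ++ drop (ℓ j) (P k)) (P≡pref k) ⟩
      take (ℓ j) (pref w (ℓ k)) ++ drop (ℓ j) (P k)
                                            ≡⟨ cong (_++ drop (ℓ j) (P k)) (take-pref w ℓⱼ≤ℓₖ) ⟩
      pref w (ℓ j) ++ drop (ℓ j) (P k)      ≡⟨ cong (_++ drop (ℓ j) (P k)) (P≡pref j) ⟨
      P j ++ drop (ℓ j) (P k)               ∎
      where open ≡-Reasoning

    P-palindrome : ∀ k → Palindrome (P k)
    P-palindrome = <-rec (λ k → Palindrome (P k)) palindrome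
      where
      palindrome : ∀ k → (∀ {j} → j < k → Palindrome (P j)) → Palindrome (P k)
      palindrome zero    _       = refl
      palindrome (suc k) earlier with step k
      ... | letter a eq     = subst Palindrome (sym eq) (u++a∷u-palindrome a (earlier (n<1+n k)))
      ... | return j j<k eq =
        subst Palindrome (sym (trans eq (cong (_++ drop (ℓ j) (P k)) Pₖ≡Pⱼ++s)))
              (p++s++s-palindrome (earlier (m<n⇒m<1+n j<k)) (subst Palindrome Pₖ≡Pⱼ++s (earlier (n<1+n k))))
        where
        Pₖ≡Pⱼ++s : P k ≡ P j ++ drop (ℓ j) (P k)
        Pₖ≡Pⱼ++s = P-prefix {j} {k} (<⇒≤ (ℓ-< j<k))

    palindromeLengths-doublingBounded : ∀ {n} → StrictlyIncreasing n →
      (∀ m → Palindrome (pref w m) ⇔ (∃[ i ] n i ≡ m)) → DoublingBounded n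
    palindromeLengths-doublingBounded {n} n-inc pal =
      doublingBounded-fromSubsequence n-inc (λ k → ℓ-< (n<1+n k)) refl ℓ⊆n ℓ-doublingBounded
      where
      ℓ⊆n : ∀ k → ∃[ i ] n i ≡ ℓ k
      ℓ⊆n k = Equivalence.to (pal (ℓ k)) (subst Palindrome (P≡pref k) (P-palindrome k))

module ToAdmissible {A : Set} {w : ℕ → A} {n : ℕ → ℕ} (n-inc : StrictlyIncreasing n)
  (pal : ∀ m → Palindrome (pref w m) ⇔ (∃[ i ] n i ≡ m)) (n-dbl : DoublingBounded n) where

  mirror : ∀ i → Mirror w (n i)
  mirror i = palindrome⇒mirror (Equivalence.from (pal (n i)) (i , refl))

  n₀≡0 : n 0 ≡ 0
  n₀≡0 with Equivalence.to (pal 0) refl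
  ... | i , nᵢ≡0 = n≤0⇒n≡0 (subst (n 0 ≤_) nᵢ≡0 (strictlyIncreasing⇒monotone n-inc z≤n))

  data Gap (i : ℕ) : Set where
    centre : n i + suc (n i) ≡ n (suc i) → Gap i
    return : ∀ j K → j < i → n j + K ≡ n i → n i + K ≡ n (suc i) → Gap i

  gap≤1+n : ∀ i {K} → n i + K ≡ n (suc i) → K ≤ suc (n i)
  gap≤1+n i {K} nᵢ+K≡nᵢ₊₁ = +-cancelˡ-≤ (n i) K (suc (n i)) (begin
    n i + K          ≡⟨ nᵢ+K≡nᵢ₊₁ ⟩
    n (suc i)        ≤⟨ n-dbl i ⟩
    2 * n i + 1      ≡⟨ 2*n+1≡n+[1+n] (n i) ⟩
    n i + suc (n i)  ∎)
    where open ≤-Reasoning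

  classify : ∀ i {K} → 0 < K → n i + K ≡ n (suc i) → Gap i
  classify i {K} 0<K nᵢ+K≡nᵢ₊₁ with m≤n⇒m<n∨m≡n (gap≤1+n i nᵢ+K≡nᵢ₊₁)
  ... | inj₂ refl = centre nᵢ+K≡nᵢ₊₁
  ... | inj₁ (s≤s K≤nᵢ) with Equivalence.to (pal (n i ∸ K))
        (mirror⇒palindrome (mirrors⇒mirror (mirror (suc i)) (mirror i) (m∸n+n≡m K≤nᵢ) nᵢ+K≡nᵢ₊₁))
  ... | j , nⱼ≡M = return j K j<i nⱼ+K≡nᵢ nᵢ+K≡nᵢ₊₁
    where
    nⱼ+K≡nᵢ : n j + K ≡ n i
    nⱼ+K≡nᵢ = trans (cong (_+ K) nⱼ≡M) (m∸n+n≡m K≤nᵢ)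
    j<i : j < i
    j<i = strictlyIncreasing⇒reflects-< n-inc (subst (n j <_) nⱼ+K≡nᵢ (m<m+n (n j) 0<K))

  gap : ∀ i → Gap i
  gap i = classify i (m<n⇒0<n∸m (n-inc i)) (m+[n∸m]≡n (<⇒≤ (n-inc i)))

  letterOrReturn : ∀ {i} → Gap i → ℕ ⊎ A
  letterOrReturn {i} (centre _)         = inj₂ (w (n i))
  letterOrReturn     (return j _ _ _ _) = inj₁ (suc j)

  ψ : ℕ → ℕ ⊎ A
  ψ zero    = inj₁ zero
  ψ (suc i) = letterOrReturn (gap i)

  ψ-admissible : Admissible ψ
  ψ-admissible (suc i) _ with gap i
  ... | centre _           = inj₁ (w (n i) , refl)
  ... | return j _ j<i _ _ = inj₂ (suc j , refl , s≤s z≤n , j<i)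

  π≡pref : ∀ i → π ψ (suc i) ≡ pref w (n i)
  π≡pref = <-rec (λ i → π ψ (suc i) ≡ pref w (n i)) π≡pref-step
    where
    open ≡-Reasoning
    π≡pref-step : ∀ i → (∀ {j} → j < i → π ψ (suc j) ≡ pref w (n j)) → π ψ (suc i) ≡ pref w (n i)
    π≡pref-step zero    _       = cong (pref w) (sym n₀≡0)
    π≡pref-step (suc i) earlier with gap i in gapᵢ
    ... | centre nᵢ+1+nᵢ≡nᵢ₊₁ = begin
      π ψ (suc (suc i))                        ≡⟨ π-letter ψ (cong letterOrReturn gapᵢ) ⟩
      π ψ (suc i) ++ w (n i) ∷ π ψ (suc i)     ≡⟨ cong (λ u → u ++ w (n i) ∷ u) (earlier (n<1+n i)) ⟩
      pref w (n i) ++ w (n i) ∷ pref w (n i)   ≡⟨ pref-centre (mirror (suc i)) (mirror i) nᵢ+1+nᵢ≡nᵢ₊₁ ⟨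
      pref w (n (suc i))                       ∎
    ... | return j K j<i nⱼ+K≡nᵢ nᵢ+K≡nᵢ₊₁ = begin
      π ψ (suc (suc i))
        ≡⟨ π-return ψ (cong letterOrReturn gapᵢ) (s≤s (<⇒≤ j<i)) ⟩
      π ψ (suc i) ++ drop (length (π ψ (suc j))) (π ψ (suc i))
        ≡⟨ cong₂ (λ u v → u ++ drop (length v) u) (earlier (n<1+n i)) (earlier (m<n⇒m<1+n j<i)) ⟩
      pref w (n i) ++ drop (length (pref w (n j))) (pref w (n i))
        ≡⟨ cong (λ m → pref w (n i) ++ drop m (pref w (n i))) (length-pref w (n j)) ⟩
      pref w (n i) ++ drop (n j) (pref w (n i))
        ≡⟨ pref-return (mirror (suc i)) (mirror i) nⱼ+K≡nᵢ nᵢ+K≡nᵢ₊₁ ⟨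
      pref w (n (suc i))
        ∎

  ψ-generates : IsWψ ψ w
  ψ-generates (suc i) _ = begin
    pref w (length (π ψ (suc i)))   ≡⟨ cong (pref w ∘ length) (π≡pref i) ⟩
    pref w (length (pref w (n i)))  ≡⟨ cong (pref w) (length-pref w (n i)) ⟩
    pref w (n i)                    ≡⟨ π≡pref i ⟨
    π ψ (suc i)                     ∎
    where open ≡-Reasoning

theorem4p2 : {A : Set} (w : ℕ → A) (n : ℕ → ℕ)
    → StrictlyIncreasing n
    → (∀ m → Palindrome (pref w m) ⇔ (∃[ i ] n i ≡ m))
    → ((∀ i → n (suc i) ≤ 2 * n i + 1)
       ⇔ (∃[ ψ ] (Admissible {A} ψ × IsWψ ψ w)))
theorem4p2 w n n-inc pal = mk⇔
  (λ n-dbl → let open ToAdmissible n-inc pal n-dbl in ψ , ψ-admissible , ψ-generates)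
  (λ (_ , ψ-adm , ψ-gen) → FromAdmissible.palindromeLengths-doublingBounded ψ-adm ψ-gen n-inc pal)
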